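{- Let $k$ and $r$ be positive integers. Then, as formal power series in $q$ (equivalently, for complex $|q|<1$), $$(-q;q)_\infty \left( 1+2\sum_{j=1}^k (-1)^j q^{r j^2} \right) = \frac{(-q;q)_\infty (q^r;q^r)_\infty}{(-q^r;q^r)_\infty} + 2(-1)^k q^{r(k+1)^2} \frac{(q^r;q^{2r})_\infty}{(q;q^2)_\infty} \sum_{j=0}^{\infty}\frac{q^{(2k+2j+3)rj}}{(q^{2r};q^{2r})_j(q^r;q^{2r})_{k+j+1}}.$$
   Context: The $q$-Pochhammer symbol is $(a;q)_0=1$, $(a;q)_n=(1-a)(1-aq)\cdots(1-aq^{n-1})$ for $n>0$, and $(a;q)_\infty=\lim_{n\to\infty}(a;q)_n$. -}

module Defs where

open import Data.Nat as ℕ using (ℕ; zero; suc; _∸_; _≤ᵇ_; _≡ᵇ_)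
open import Data.Integer as ℤ using (ℤ; +_; -_; _+_; _*_; _^_)
open import Data.Bool using (if_then_else_)
open import Relation.Binary.PropositionalEquality using (_≡_)

-- Formal power series in q with integer coefficients: n ↦ coefficient of q^n.
PS : Set
PS = ℕ → ℤ

infix 4 _≐_
_≐_ : PS → PS → Set
f ≐ g = ∀ n → f n ≡ g n

cst : ℤ → PS
cst c zero    = c
cst c (suc _) = + 0

mon : ℤ → ℕ → PS
mon c e n = if n ≡ᵇ e then c else + 0

infixl 6 _⊕_ _⊖_
infixl 7 _⊛_ _·_

_⊕_ : PS → PS → PS
(f ⊕ g) n = f n + g n

_⊖_ : PS → PS → PS
(f ⊖ g) n = f n ℤ.- g n

_·_ : ℤ → PS → PS
(c · f) n = c * f n

Σℤ : ℕ → (ℕ → ℤ) → ℤ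
Σℤ zero    a = + 0
Σℤ (suc m) a = Σℤ m a + a m

_⊛_ : PS → PS → PS
(f ⊛ g) n = Σℤ (suc n) (λ i → f i * g (n ∸ i))

sumTo : ℕ → (ℕ → PS) → PS
sumTo zero    t = cst (+ 0)
sumTo (suc m) t = sumTo m t ⊕ t m

prodTo : ℕ → (ℕ → PS) → PS
prodTo zero    t = cst (+ 1)
prodTo (suc m) t = prodTo m t ⊛ t m

-- Multiplicative inverse of a series with constant term 1:
-- b₀ = 1, b_n = - Σ_{k=1}^{n} a_k b_{n-k}.
-- invTab f n m = b_m for m ≤ n (and 0 beyond).
invTab : PS → ℕ → ℕ → ℤ
invTab f zero    m = cst (+ 1) m
invTab f (suc n) m =
  if m ≤ᵇ n then invTab f n m
  else (if m ≡ᵇ suc n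
        then - Σℤ (suc n) (λ i → f (suc i) * invTab f n (n ∸ i))
        else + 0)

inv : PS → PS
inv f n = invTab f n n

poch : ℤ → ℕ → ℕ → ℕ → PS
poch c m d n = prodTo n (λ i → cst (+ 1) ⊖ mon c (m ℕ.+ d ℕ.* i))

-- Infinite q-Pochhammer (c q^m ; q^d)_∞, for m ≥ 1, d ≥ 1.
-- Then the i-th factor is 1 + O(q^{i+1}), so the coefficient of q^n of the
-- infinite product equals that of the product of the first n+1 factors.
pochInf : ℤ → ℕ → ℕ → PS
pochInf c m d n = poch c m d (suc n) n

-- Infinite sum Σ_{j≥0} t j of series where t j = O(q^j):
-- coefficient of q^n only involves j ≤ n.
sumInf : (ℕ → PS) → PS
sumInf t n = sumTo (suc n) t n

sgn : ℕ → ℤ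
sgn j = (- + 1) ^ j

{-# OPTIONS --safe #-}

-- Write x = q^r and G b s = Σ_j x^{j(2b+2j-1)} / ((x²;x²)_j (x;x²)_{s+j}). Removing one
-- factor from either Pochhammer symbol in the denominator gives two three-term recurrences
-- for G. On the diagonal they show that G b b - G (b+1) (b+1) vanishes to every order, so
-- G b b = 1/(x;x²)_∞, and then F a = (x;x²)_∞ G (a+1) a satisfies F a = 1 - x^{2a+1} F (a+1),
-- which telescopes into the finite sum of signed x^{j²}. Likewise G c 0 - x^c G (c+1) 1
-- and (x^c;x)_∞ satisfy the same first-order recurrence and agree to order x^c, hence are
-- equal; with Euler's (-x;x)_∞ (x;x²)_∞ = 1 this gives (x;x)_∞/(-x;x)_∞ = 2 F 0 - 1.
-- Multiplying by (-q;q)_∞ = 1/(q;q²)_∞ yields the identity.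
module Submission where

open import Defs
open import Data.Nat as ℕ using (ℕ; zero; suc; _∸_; _≤_; _<_; z≤n; s≤s; _≡ᵇ_; _≤ᵇ_)
import Data.Nat.Properties as ℕₚ
open import Data.Nat.Tactic.RingSolver using (solve-∀)
open import Data.Integer using (ℤ; +_; -_)
import Data.Integer as ℤ
import Data.Integer.Properties as ℤₚ
open import Data.Bool using (true; false)
open import Data.Bool.Properties using (T-≡; ¬-not)
open import Data.Maybe using (Maybe; just; nothing)
open import Data.Product using (_,_)
open import Function using (_∘_; Equivalence)
open import Level using (0ℓ)
open import Relation.Binary.PropositionalEquality
open import Relation.Nullary using (yes; no)
open import Algebra.Bundles using (CommutativeRing)
open import Algebra.Solver.Ring.AlmostCommutativeRing
  using (_-Raw-AlmostCommutative⟶_; fromCommutativeRing)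
import Algebra.Solver.Ring
import Relation.Binary.Reasoning.Setoid

module _ where
  open import Data.Integer using (_+_; _*_)
  open import Algebra.Properties.CommutativeSemigroup ℤₚ.+-commutativeSemigroup
    using () renaming (interchange to +-interchange)
  open ≡-Reasoning

  Σℤ-cong< : ∀ m {a b : ℕ → ℤ} → (∀ i → i < m → a i ≡ b i) → Σℤ m a ≡ Σℤ m b
  Σℤ-cong< zero    a≡b = refl
  Σℤ-cong< (suc m) a≡b =
    cong₂ _+_ (Σℤ-cong< m (λ i i<m → a≡b i (ℕₚ.m<n⇒m<1+n i<m))) (a≡b m ℕₚ.≤-refl)

  Σℤ-cong : ∀ m {a b : ℕ → ℤ} → (∀ i → a i ≡ b i) → Σℤ m a ≡ Σℤ m b
  Σℤ-cong m a≡b = Σℤ-cong< m (λ i _ → a≡b i)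

  Σℤ-zero : ∀ m {a : ℕ → ℤ} → (∀ i → i < m → a i ≡ + 0) → Σℤ m a ≡ + 0
  Σℤ-zero zero    a≡0 = refl
  Σℤ-zero (suc m) a≡0 =
    cong₂ _+_ (Σℤ-zero m (λ i i<m → a≡0 i (ℕₚ.m<n⇒m<1+n i<m))) (a≡0 m ℕₚ.≤-refl)

  Σℤ-+ : ∀ m (a b : ℕ → ℤ) → Σℤ m (λ i → a i + b i) ≡ Σℤ m a + Σℤ m b
  Σℤ-+ zero    a b = refl
  Σℤ-+ (suc m) a b =
    trans (cong (_+ (a m + b m)) (Σℤ-+ m a b)) (+-interchange (Σℤ m a) (Σℤ m b) (a m) (b m))

  Σℤ-*ˡ : ∀ m c (a : ℕ → ℤ) → c * Σℤ m a ≡ Σℤ m (λ i → c * a i)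
  Σℤ-*ˡ zero    c a = ℤₚ.*-zeroʳ c
  Σℤ-*ˡ (suc m) c a =
    trans (ℤₚ.*-distribˡ-+ c (Σℤ m a) (a m)) (cong (_+ c * a m) (Σℤ-*ˡ m c a))

  Σℤ-*ʳ : ∀ m c (a : ℕ → ℤ) → Σℤ m a * c ≡ Σℤ m (λ i → a i * c)
  Σℤ-*ʳ m c a = begin
    Σℤ m a * c              ≡⟨ ℤₚ.*-comm (Σℤ m a) c ⟩
    c * Σℤ m a              ≡⟨ Σℤ-*ˡ m c a ⟩
    Σℤ m (λ i → c * a i)    ≡⟨ Σℤ-cong m (λ i → ℤₚ.*-comm c (a i)) ⟩
    Σℤ m (λ i → a i * c)    ∎

  Σℤ-neg : ∀ m (a : ℕ → ℤ) → - Σℤ m a ≡ Σℤ m (λ i → - a i)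
  Σℤ-neg zero    a = refl
  Σℤ-neg (suc m) a =
    trans (ℤₚ.neg-distrib-+ (Σℤ m a) (a m)) (cong (_+ - a m) (Σℤ-neg m a))

  Σℤ-head : ∀ m (a : ℕ → ℤ) → Σℤ (suc m) a ≡ a 0 + Σℤ m (a ∘ suc)
  Σℤ-head zero    a = ℤₚ.+-comm (+ 0) (a 0)
  Σℤ-head (suc m) a =
    trans (cong (_+ a (suc m)) (Σℤ-head m a)) (ℤₚ.+-assoc (a 0) (Σℤ m (a ∘ suc)) (a (suc m)))

  Σℤ-reverse : ∀ m (a : ℕ → ℤ) → Σℤ m a ≡ Σℤ m (λ i → a (m ∸ suc i))
  Σℤ-reverse zero    a = refl
  Σℤ-reverse (suc m) a = begin
    Σℤ m a + a m                        ≡⟨ cong (_+ a m) (Σℤ-reverse m a) ⟩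
    Σℤ m (λ i → a (m ∸ suc i)) + a m    ≡⟨ ℤₚ.+-comm _ (a m) ⟩
    a m + Σℤ m (λ i → a (m ∸ suc i))    ≡⟨ Σℤ-head m (λ i → a (suc m ∸ suc i)) ⟨
    Σℤ (suc m) (λ i → a (suc m ∸ suc i)) ∎

  Σℤ-swap : ∀ m n (a : ℕ → ℕ → ℤ) →
    Σℤ m (λ i → Σℤ n (a i)) ≡ Σℤ n (λ j → Σℤ m (λ i → a i j))
  Σℤ-swap zero    n a = sym (Σℤ-zero n (λ _ _ → refl))
  Σℤ-swap (suc m) n a =
    trans (cong (_+ Σℤ n (a m)) (Σℤ-swap m n a)) (sym (Σℤ-+ n _ (a m)))

  Σℤ-triangle : ∀ n (b : ℕ → ℕ → ℤ) →
    Σℤ (suc n) (λ m → Σℤ (suc m) (λ i → b i (m ∸ i))) ≡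
    Σℤ (suc n) (λ i → Σℤ (suc (n ∸ i)) (b i))
  Σℤ-triangle zero    b = refl
  Σℤ-triangle (suc n) b = begin
    Diagonals + Σℤ (suc (suc n)) (λ i → b i (suc n ∸ i))
      ≡⟨ cong (_+ Σℤ (suc (suc n)) (λ i → b i (suc n ∸ i))) (Σℤ-triangle n b) ⟩
    Rows + (Σℤ (suc n) (λ i → b i (suc n ∸ i)) + b (suc n) (n ∸ n))
      ≡⟨ ℤₚ.+-assoc Rows _ _ ⟨
    Rows + Σℤ (suc n) (λ i → b i (suc n ∸ i)) + b (suc n) (n ∸ n)
      ≡⟨ cong (_+ b (suc n) (n ∸ n)) (Σℤ-+ (suc n) _ _) ⟨
    Σℤ (suc n) (λ i → Σℤ (suc (n ∸ i)) (b i) + b i (suc n ∸ i)) + b (suc n) (n ∸ n)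
      ≡⟨ cong (_+ b (suc n) (n ∸ n)) (Σℤ-cong< (suc n) longer-row) ⟩
    Σℤ (suc n) (λ i → Σℤ (suc (suc n ∸ i)) (b i)) + b (suc n) (n ∸ n)
      ≡⟨ cong (λ x → Σℤ (suc n) (λ i → Σℤ (suc (suc n ∸ i)) (b i)) + x) last-row ⟩
    Σℤ (suc (suc n)) (λ i → Σℤ (suc (suc n ∸ i)) (b i)) ∎
    where
    Diagonals = Σℤ (suc n) (λ m → Σℤ (suc m) (λ i → b i (m ∸ i)))
    Rows      = Σℤ (suc n) (λ i → Σℤ (suc (n ∸ i)) (b i))
    longer-row : ∀ i → i < suc n →
      Σℤ (suc (n ∸ i)) (b i) + b i (suc n ∸ i) ≡ Σℤ (suc (suc n ∸ i)) (b i)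
    longer-row i i<1+n rewrite ℕₚ.+-∸-assoc 1 (ℕₚ.≤-pred i<1+n) = refl
    last-row : b (suc n) (n ∸ n) ≡ Σℤ (suc (suc n ∸ suc n)) (b (suc n))
    last-row rewrite ℕₚ.n∸n≡0 n = sym (ℤₚ.+-identityˡ (b (suc n) 0))

  Σℤ-single : ∀ m e (a : ℕ → ℤ) → e < m → (∀ i → i < m → i ≢ e → a i ≡ + 0) →
    Σℤ m a ≡ a e
  Σℤ-single (suc m) e a e<1+m a≡0 with e ℕₚ.≟ m
  ... | yes refl = begin
    Σℤ e a + a e ≡⟨ cong (_+ a e) (Σℤ-zero e (λ i i<e → a≡0 i (ℕₚ.m<n⇒m<1+n i<e) (ℕₚ.<⇒≢ i<e))) ⟩
    + 0 + a e    ≡⟨ ℤₚ.+-identityˡ (a e) ⟩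
    a e          ∎
  ... | no e≢m = begin
    Σℤ m a + a m ≡⟨ cong₂ _+_ (Σℤ-single m e a e<m (λ i i<m → a≡0 i (ℕₚ.m<n⇒m<1+n i<m)))
                              (a≡0 m ℕₚ.≤-refl (e≢m ∘ sym)) ⟩
    a e + + 0    ≡⟨ ℤₚ.+-identityʳ (a e) ⟩
    a e          ∎
    where e<m = ℕₚ.≤∧≢⇒< (ℕₚ.≤-pred e<1+m) e≢m

  Σℤ-extend : ∀ m k (a : ℕ → ℤ) → (∀ j → m ≤ j → a j ≡ + 0) → Σℤ (k ℕ.+ m) a ≡ Σℤ m a
  Σℤ-extend m zero    a a≡0 = refl
  Σℤ-extend m (suc k) a a≡0 = begin
    Σℤ (k ℕ.+ m) a + a (k ℕ.+ m) ≡⟨ cong (λ x → Σℤ (k ℕ.+ m) a + x) (a≡0 (k ℕ.+ m) (ℕₚ.m≤n+m m k)) ⟩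
    Σℤ (k ℕ.+ m) a + + 0         ≡⟨ ℤₚ.+-identityʳ _ ⟩
    Σℤ (k ℕ.+ m) a               ≡⟨ Σℤ-extend m k a a≡0 ⟩
    Σℤ m a                       ∎

  -- The ring of formal power series

  infix 8 ⊝_
  ⊝_ : PS → PS
  (⊝ f) n = - f n

  0ₛ 1ₛ : PS
  0ₛ _ = + 0
  1ₛ = cst (+ 1)

  ≐-refl : ∀ {f} → f ≐ f
  ≐-refl n = refl

  ≐-sym : ∀ {f g} → f ≐ g → g ≐ f
  ≐-sym f≐g n = sym (f≐g n)

  ≐-trans : ∀ {f g h} → f ≐ g → g ≐ h → f ≐ h
  ≐-trans f≐g g≐h n = trans (f≐g n) (g≐h n)

  ≡⇒≐ : ∀ {f g} → f ≡ g → f ≐ g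
  ≡⇒≐ refl = ≐-refl

  ⊖≐0⇒≐ : ∀ {f g} → f ⊖ g ≐ 0ₛ → f ≐ g
  ⊖≐0⇒≐ {f} {g} f⊖g≐0 n = ℤₚ.i-j≡0⇒i≡j (f n) (g n) (f⊖g≐0 n)

  ⊕-cong : ∀ {f f′ g g′} → f ≐ f′ → g ≐ g′ → f ⊕ g ≐ f′ ⊕ g′
  ⊕-cong f≐f′ g≐g′ n = cong₂ _+_ (f≐f′ n) (g≐g′ n)

  ⊝-cong : ∀ {f g} → f ≐ g → ⊝ f ≐ ⊝ g
  ⊝-cong f≐g n = cong -_ (f≐g n)

  ⊖-cong : ∀ {f f′ g g′} → f ≐ f′ → g ≐ g′ → f ⊖ g ≐ f′ ⊖ g′
  ⊖-cong f≐f′ g≐g′ n = cong₂ ℤ._-_ (f≐f′ n) (g≐g′ n)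

  ⊛-cong : ∀ {f f′ g g′} → f ≐ f′ → g ≐ g′ → f ⊛ g ≐ f′ ⊛ g′
  ⊛-cong f≐f′ g≐g′ n = Σℤ-cong (suc n) (λ i → cong₂ _*_ (f≐f′ i) (g≐g′ (n ∸ i)))

  ⊛-zero : ∀ f g → (f ⊛ g) 0 ≡ f 0 * g 0
  ⊛-zero f g = ℤₚ.+-identityˡ (f 0 * g 0)

  ⊛-comm : ∀ f g → f ⊛ g ≐ g ⊛ f
  ⊛-comm f g n = begin
    Σℤ (suc n) (λ i → f i * g (n ∸ i))             ≡⟨ Σℤ-reverse (suc n) _ ⟩
    Σℤ (suc n) (λ i → f (n ∸ i) * g (n ∸ (n ∸ i))) ≡⟨ Σℤ-cong< (suc n) swap ⟩
    Σℤ (suc n) (λ i → g i * f (n ∸ i))             ∎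
    where
    swap : ∀ i → i < suc n → f (n ∸ i) * g (n ∸ (n ∸ i)) ≡ g i * f (n ∸ i)
    swap i i<1+n rewrite ℕₚ.m∸[m∸n]≡n (ℕₚ.≤-pred i<1+n) = ℤₚ.*-comm (f (n ∸ i)) (g i)

  ⊛-assoc : ∀ f g h → (f ⊛ g) ⊛ h ≐ f ⊛ (g ⊛ h)
  ⊛-assoc f g h n = begin
    Σℤ (suc n) (λ m → Σℤ (suc m) (λ i → f i * g (m ∸ i)) * h (n ∸ m))
      ≡⟨ Σℤ-cong (suc n) (λ m → Σℤ-*ʳ (suc m) (h (n ∸ m)) _) ⟩
    Σℤ (suc n) (λ m → Σℤ (suc m) (λ i → f i * g (m ∸ i) * h (n ∸ m)))
      ≡⟨ Σℤ-cong (suc n) (λ m → Σℤ-cong< (suc m) (λ i i<1+m → diagonal-index m i (ℕₚ.≤-pred i<1+m))) ⟩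
    Σℤ (suc n) (λ m → Σℤ (suc m) (λ i → b i (m ∸ i)))
      ≡⟨ Σℤ-triangle n b ⟩
    Σℤ (suc n) (λ i → Σℤ (suc (n ∸ i)) (b i))
      ≡⟨ Σℤ-cong (suc n) (λ i → Σℤ-cong (suc (n ∸ i)) (row-index i)) ⟩
    Σℤ (suc n) (λ i → Σℤ (suc (n ∸ i)) (λ j → f i * (g j * h (n ∸ i ∸ j))))
      ≡⟨ Σℤ-cong (suc n) (λ i → Σℤ-*ˡ (suc (n ∸ i)) (f i) _) ⟨
    Σℤ (suc n) (λ i → f i * Σℤ (suc (n ∸ i)) (λ j → g j * h (n ∸ i ∸ j))) ∎
    where
    b : ℕ → ℕ → ℤ
    b i j = f i * g j * h (n ∸ (i ℕ.+ j))
    diagonal-index : ∀ m i → i ≤ m → f i * g (m ∸ i) * h (n ∸ m) ≡ b i (m ∸ i)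
    diagonal-index m i i≤m rewrite ℕₚ.m+[n∸m]≡n i≤m = refl
    row-index : ∀ i j → b i j ≡ f i * (g j * h (n ∸ i ∸ j))
    row-index i j rewrite ℕₚ.∸-+-assoc n i j = ℤₚ.*-assoc (f i) (g j) _

  ⊛-distribˡ-⊕ : ∀ f g h → f ⊛ (g ⊕ h) ≐ f ⊛ g ⊕ f ⊛ h
  ⊛-distribˡ-⊕ f g h n = trans
    (Σℤ-cong (suc n) (λ i → ℤₚ.*-distribˡ-+ (f i) (g (n ∸ i)) (h (n ∸ i))))
    (Σℤ-+ (suc n) _ _)

  ⊛-distribʳ-⊕ : ∀ f g h → (g ⊕ h) ⊛ f ≐ g ⊛ f ⊕ h ⊛ f
  ⊛-distribʳ-⊕ f g h n = trans
    (Σℤ-cong (suc n) (λ i → ℤₚ.*-distribʳ-+ (f (n ∸ i)) (g i) (h i)))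
    (Σℤ-+ (suc n) _ _)

  cst-⊛ : ∀ c f → cst c ⊛ f ≐ c · f
  cst-⊛ c f n = begin
    Σℤ (suc n) (λ i → cst c i * f (n ∸ i)) ≡⟨ Σℤ-head n _ ⟩
    c * f n + Σℤ n (λ i → + 0 * f (n ∸ suc i)) ≡⟨ cong (λ x → c * f n + x) (Σℤ-zero n (λ _ _ → refl)) ⟩
    c * f n + + 0                            ≡⟨ ℤₚ.+-identityʳ (c * f n) ⟩
    c * f n                                  ∎

  ⊛-identityˡ : ∀ f → 1ₛ ⊛ f ≐ f
  ⊛-identityˡ f n = trans (cst-⊛ (+ 1) f n) (ℤₚ.*-identityˡ (f n))

  ⊛-identityʳ : ∀ f → f ⊛ 1ₛ ≐ f
  ⊛-identityʳ f = ≐-trans (⊛-comm f 1ₛ) (⊛-identityˡ f)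

  PS-commutativeRing : CommutativeRing 0ℓ 0ℓ
  PS-commutativeRing = record
    { Carrier = PS ; _≈_ = _≐_ ; _+_ = _⊕_ ; _*_ = _⊛_ ; -_ = ⊝_ ; 0# = 0ₛ ; 1# = 1ₛ
    ; isCommutativeRing = record
      { isRing = record
        { +-isAbelianGroup = record
          { isGroup = record
            { isMonoid = record
              { isSemigroup = record
                { isMagma = record
                  { isEquivalence = record { refl = ≐-refl ; sym = ≐-sym ; trans = ≐-trans }
                  ; ∙-cong = ⊕-cong }
                ; assoc = λ f g h n → ℤₚ.+-assoc (f n) (g n) (h n) }
              ; identity = (λ f n → ℤₚ.+-identityˡ (f n)) , (λ f n → ℤₚ.+-identityʳ (f n)) }
            ; inverse = (λ f n → ℤₚ.+-inverseˡ (f n)) , (λ f n → ℤₚ.+-inverseʳ (f n))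
            ; ⁻¹-cong = ⊝-cong }
          ; comm = λ f g n → ℤₚ.+-comm (f n) (g n) }
        ; *-cong = ⊛-cong
        ; *-assoc = ⊛-assoc
        ; *-identity = ⊛-identityˡ , ⊛-identityʳ
        ; distrib = ⊛-distribˡ-⊕ , ⊛-distribʳ-⊕ }
      ; *-comm = ⊛-comm } }

  cst-homomorphism : CommutativeRing.rawRing ℤₚ.+-*-commutativeRing
                       -Raw-AlmostCommutative⟶ fromCommutativeRing PS-commutativeRing
  cst-homomorphism = record
    { ⟦_⟧    = cst
    ; +-homo = λ { c d zero → refl ; c d (suc n) → refl }
    ; *-homo = λ c d n → sym (trans (cst-⊛ c (cst d) n) (cst-* c d n))
    ; -‿homo = λ { c zero → refl ; c (suc n) → refl }
    ; 0-homo = λ { zero → refl ; (suc n) → refl }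
    ; 1-homo = ≐-refl }
    where
    cst-* : ∀ c d n → c * cst d n ≡ cst (c * d) n
    cst-* c d zero    = refl
    cst-* c d (suc n) = ℤₚ.*-zeroʳ c

  cst-≟ : ∀ c d → Maybe (cst c ≐ cst d)
  cst-≟ c d with c ℤₚ.≟ d
  ... | yes refl = just ≐-refl
  ... | no _     = nothing

open Algebra.Solver.Ring _ _ cst-homomorphism cst-≟ using (solve; _:=_; _:+_; _:*_; _:-_; :-_; con)
module ≐-Reasoning = Relation.Binary.Reasoning.Setoid (CommutativeRing.setoid PS-commutativeRing)

≡ᵇ-refl : ∀ n → (n ≡ᵇ n) ≡ true
≡ᵇ-refl zero    = refl
≡ᵇ-refl (suc n) = ≡ᵇ-refl n

≡ᵇ-false : ∀ {m n} → m ≢ n → (m ≡ᵇ n) ≡ false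
≡ᵇ-false {m} {n} m≢n = ¬-not (m≢n ∘ ℕₚ.≡ᵇ⇒≡ m n ∘ Equivalence.from T-≡)

≤ᵇ-true : ∀ {m n} → m ≤ n → (m ≤ᵇ n) ≡ true
≤ᵇ-true m≤n = Equivalence.to T-≡ (ℕₚ.≤⇒≤ᵇ m≤n)

1+n≤ᵇn-false : ∀ n → (suc n ≤ᵇ n) ≡ false
1+n≤ᵇn-false zero    = refl
1+n≤ᵇn-false (suc n) = 1+n≤ᵇn-false n

module _ where
  open import Data.Integer using (_+_; _*_)

  invTab-stable : ∀ f n m → m ≤ n → invTab f n m ≡ inv f m
  invTab-stable f zero    .zero z≤n = refl
  invTab-stable f (suc n) m m≤1+n with m ℕₚ.≤? n
  ... | yes m≤n rewrite ≤ᵇ-true m≤n = invTab-stable f n m m≤n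
  ... | no  m≰n rewrite ℕₚ.≤-antisym m≤1+n (ℕₚ.≰⇒> m≰n) = refl

  inv-suc : ∀ f n → inv f (suc n) ≡ - Σℤ (suc n) (λ i → f (suc i) * inv f (n ∸ i))
  inv-suc f n rewrite 1+n≤ᵇn-false n | ≡ᵇ-refl n =
    cong -_ (Σℤ-cong (suc n) (λ i → cong (f (suc i) *_) (invTab-stable f n (n ∸ i) (ℕₚ.m∸n≤m n i))))

  ⊛-inverseʳ : ∀ f → f 0 ≡ + 1 → f ⊛ inv f ≐ 1ₛ
  ⊛-inverseʳ f f₀≡1 zero    = trans (⊛-zero f (inv f)) (cong (_* + 1) f₀≡1)
  ⊛-inverseʳ f f₀≡1 (suc n) = begin
    Σℤ (suc (suc n)) (λ i → f i * inv f (suc n ∸ i)) ≡⟨ Σℤ-head (suc n) _ ⟩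
    f 0 * inv f (suc n) + S                          ≡⟨ cong (λ c → c * inv f (suc n) + S) f₀≡1 ⟩
    + 1 * inv f (suc n) + S                          ≡⟨ cong (_+ S) (ℤₚ.*-identityˡ (inv f (suc n))) ⟩
    inv f (suc n) + S                                ≡⟨ cong (_+ S) (inv-suc f n) ⟩
    - S + S                                          ≡⟨ ℤₚ.+-inverseˡ S ⟩
    + 0                                              ∎
    where
    open ≡-Reasoning
    S = Σℤ (suc n) (λ i → f (suc i) * inv f (n ∸ i))

  inv-unique : ∀ f g → f 0 ≡ + 1 → f ⊛ g ≐ 1ₛ → g ≐ inv f
  inv-unique f g f₀≡1 fg≐1 = begin
    g                 ≈⟨ ⊛-identityʳ g ⟨
    g ⊛ 1ₛ            ≈⟨ ⊛-cong (≐-refl {g}) (⊛-inverseʳ f f₀≡1) ⟨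
    g ⊛ (f ⊛ inv f)   ≈⟨ solve 3 (λ g f h → g :* (f :* h) := (f :* g) :* h) ≐-refl g f (inv f) ⟩
    (f ⊛ g) ⊛ inv f   ≈⟨ ⊛-cong fg≐1 (≐-refl {inv f}) ⟩
    1ₛ ⊛ inv f        ≈⟨ ⊛-identityˡ (inv f) ⟩
    inv f             ∎
    where open ≐-Reasoning

  inv-1ₛ : inv 1ₛ ≐ 1ₛ
  inv-1ₛ = ≐-sym (inv-unique 1ₛ 1ₛ refl (⊛-identityˡ 1ₛ))

  inv-cong : ∀ {f g} → f 0 ≡ + 1 → f ≐ g → inv f ≐ inv g
  inv-cong {f} {g} f₀≡1 f≐g = inv-unique g (inv f) (trans (sym (f≐g 0)) f₀≡1)
    (≐-trans (⊛-cong (≐-sym f≐g) (≐-refl {inv f})) (⊛-inverseʳ f f₀≡1))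

  ⊛-constant-one : ∀ {f g} → f 0 ≡ + 1 → g 0 ≡ + 1 → (f ⊛ g) 0 ≡ + 1
  ⊛-constant-one {f} {g} f₀≡1 g₀≡1 = trans (⊛-zero f g) (cong₂ _*_ f₀≡1 g₀≡1)

  inv-⊛-cancelʳ : ∀ f g h → f 0 ≡ + 1 → g 0 ≡ + 1 → h ≐ f ⊛ g → g ⊛ inv h ≐ inv f
  inv-⊛-cancelʳ f g h f₀≡1 g₀≡1 h≐fg = inv-unique f (g ⊛ inv h) f₀≡1 (begin
    f ⊛ (g ⊛ inv h)   ≈⟨ solve 3 (λ a b c → a :* (b :* c) := (a :* b) :* c) ≐-refl f g (inv h) ⟩
    (f ⊛ g) ⊛ inv h   ≈⟨ ⊛-cong h≐fg (≐-refl {inv h}) ⟨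
    h ⊛ inv h         ≈⟨ ⊛-inverseʳ h (trans (h≐fg 0) (⊛-constant-one {f} {g} f₀≡1 g₀≡1)) ⟩
    1ₛ                ∎)
    where open ≐-Reasoning

open import Data.Nat using (_+_; _*_)

infix 4 _≐[<_]_
_≐[<_]_ : PS → ℕ → PS → Set
f ≐[< N ] g = ∀ n → n < N → f n ≡ g n

≐⇒≐[<] : ∀ {f g} N → f ≐ g → f ≐[< N ] g
≐⇒≐[<] N f≐g n _ = f≐g n

≐[<]-sym : ∀ {N f g} → f ≐[< N ] g → g ≐[< N ] f
≐[<]-sym f≐g n n<N = sym (f≐g n n<N)

≐[<]-trans : ∀ {N f g h} → f ≐[< N ] g → g ≐[< N ] h → f ≐[< N ] h
≐[<]-trans f≐g g≐h n n<N = trans (f≐g n n<N) (g≐h n n<N)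

≐[<]-weaken : ∀ {M N f g} → M ≤ N → f ≐[< N ] g → f ≐[< M ] g
≐[<]-weaken M≤N f≐g n n<M = f≐g n (ℕₚ.<-≤-trans n<M M≤N)

≐[<]-all⇒≐ : ∀ {f g} → (∀ n → f ≐[< suc n ] g) → f ≐ g
≐[<]-all⇒≐ f≐g n = f≐g n n ℕₚ.≤-refl

⊛-cong-≐[<] : ∀ {N f f′ g g′} → f ≐[< N ] f′ → g ≐[< N ] g′ → f ⊛ g ≐[< N ] f′ ⊛ g′
⊛-cong-≐[<] f≐f′ g≐g′ n n<N = Σℤ-cong< (suc n) λ i i≤n →
  cong₂ ℤ._*_ (f≐f′ i (ℕₚ.≤-<-trans (ℕₚ.≤-pred i≤n) n<N))
              (g≐g′ (n ∸ i) (ℕₚ.≤-<-trans (ℕₚ.m∸n≤m n i) n<N))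

⊛-vanishing : ∀ {M K f g} → f ≐[< M ] 0ₛ → g ≐[< K ] 0ₛ → f ⊛ g ≐[< M + K ] 0ₛ
⊛-vanishing {M} {K} {f} {g} f≐0 g≐0 n n<M+K = Σℤ-zero (suc n) product≡0
  where
  product≡0 : ∀ i → i < suc n → f i ℤ.* g (n ∸ i) ≡ + 0
  product≡0 i i≤n with i ℕₚ.<? M
  ... | yes i<M rewrite f≐0 i i<M = refl
  ... | no  i≮M = trans (cong (f i ℤ.*_) (g≐0 (n ∸ i) n∸i<K)) (ℤₚ.*-zeroʳ (f i))
    where
    n∸i<K : n ∸ i < K
    n∸i<K = ℕₚ.+-cancelˡ-< i (n ∸ i) K (begin-strict
      i + (n ∸ i) ≡⟨ ℕₚ.m+[n∸m]≡n (ℕₚ.≤-pred i≤n) ⟩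
      n           <⟨ n<M+K ⟩
      M + K       ≤⟨ ℕₚ.+-monoˡ-≤ K (ℕₚ.≮⇒≥ i≮M) ⟩
      i + K       ∎)
      where open ℕₚ.≤-Reasoning

⊛-vanishingʳ : ∀ {K} f {g} → g ≐[< K ] 0ₛ → f ⊛ g ≐[< K ] 0ₛ
⊛-vanishingʳ f = ⊛-vanishing {0} {f = f} (λ _ ())

⊛-vanishingˡ : ∀ {M f} g → f ≐[< M ] 0ₛ → f ⊛ g ≐[< M ] 0ₛ
⊛-vanishingˡ {M} {f} g f≐0 = ≐[<]-trans (≐⇒≐[<] M (⊛-comm f g)) (⊛-vanishingʳ g f≐0)

-- Each step of the recurrence raises the order of vanishing by one.
≐0-by-contraction : ∀ (D g : ℕ → PS) → (∀ b → g b ≐[< 1 ] 0ₛ) →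
  (∀ b → D b ≐ g b ⊛ D (suc b)) → ∀ b → D b ≐ 0ₛ
≐0-by-contraction D g g≐0 D≐gD b n = vanishes (suc n) b n ℕₚ.≤-refl
  where
  vanishes : ∀ n b → D b ≐[< n ] 0ₛ
  vanishes zero    b = λ _ ()
  vanishes (suc n) b = ≐[<]-trans (≐⇒≐[<] (suc n) (D≐gD b))
    (⊛-vanishing {1} {n} {g b} {D (suc b)} (g≐0 b) (vanishes n (suc b)))

≐0-by-recurrence : ∀ (D f : ℕ → PS) → (∀ c → D c ≐ f c ⊛ D (suc c)) →
  (∀ c → D c ≐[< c ] 0ₛ) → ∀ c → D c ≐ 0ₛ
≐0-by-recurrence D f D≐fD D≐0 c n = vanishes (suc n) c n (ℕₚ.m≤m+n (suc n) c)
  where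
  vanishes : ∀ k c → D c ≐[< k + c ] 0ₛ
  vanishes zero    c = D≐0 c
  vanishes (suc k) c rewrite sym (ℕₚ.+-suc k c) =
    ≐[<]-trans (≐⇒≐[<] (k + suc c) (D≐fD c)) (⊛-vanishingʳ (f c) (vanishes k (suc c)))

mon-≡ : ∀ c e → mon c e e ≡ c
mon-≡ c e rewrite ≡ᵇ-refl e = refl

mon-≢ : ∀ c {e n} → n ≢ e → mon c e n ≡ + 0
mon-≢ c n≢e rewrite ≡ᵇ-false n≢e = refl

mon-vanishing : ∀ c e → mon c e ≐[< e ] 0ₛ
mon-vanishing c e n n<e = mon-≢ c (ℕₚ.<⇒≢ n<e)

mon-zero : ∀ c → mon c 0 ≐ cst c
mon-zero c zero    = refl
mon-zero c (suc n) = refl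

mon-⊛ : ∀ c e g {n} → e ≤ n → (mon c e ⊛ g) n ≡ c ℤ.* g (n ∸ e)
mon-⊛ c e g {n} e≤n = begin
  Σℤ (suc n) (λ i → mon c e i ℤ.* g (n ∸ i)) ≡⟨ Σℤ-single (suc n) e _ (s≤s e≤n) off-e ⟩
  mon c e e ℤ.* g (n ∸ e)                    ≡⟨ cong (ℤ._* g (n ∸ e)) (mon-≡ c e) ⟩
  c ℤ.* g (n ∸ e)                            ∎
  where
  open ≡-Reasoning
  off-e : ∀ i → i < suc n → i ≢ e → mon c e i ℤ.* g (n ∸ i) ≡ + 0
  off-e i _ i≢e rewrite mon-≢ c i≢e = refl

mon-⊛-mon : ∀ a b e e′ → mon a e ⊛ mon b e′ ≐ mon (a ℤ.* b) (e + e′)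
mon-⊛-mon a b e e′ n with e ℕₚ.≤? n
... | no e≰n = trans
  (⊛-vanishing {e} {0} {mon a e} {mon b e′} (mon-vanishing a e) (λ _ ())
               n (ℕₚ.<-≤-trans (ℕₚ.≰⇒> e≰n) (ℕₚ.m≤m+n e 0)))
  (sym (mon-≢ (a ℤ.* b) (λ n≡e+e′ → e≰n (ℕₚ.m+n≤o⇒m≤o e (ℕₚ.≤-reflexive (sym n≡e+e′))))))
... | yes e≤n with n ∸ e ℕₚ.≟ e′
...   | yes refl rewrite ℕₚ.m+[n∸m]≡n e≤n =
  trans (mon-⊛ a e (mon b (n ∸ e)) e≤n) (trans (cong (a ℤ.*_) (mon-≡ b (n ∸ e))) (sym (mon-≡ (a ℤ.* b) n)))
...   | no n∸e≢e′ = trans (mon-⊛ a e (mon b e′) e≤n)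
  (trans (cong (a ℤ.*_) (mon-≢ b n∸e≢e′))
  (trans (ℤₚ.*-zeroʳ a)
  (sym (mon-≢ (a ℤ.* b) (λ n≡e+e′ → n∸e≢e′ (trans (cong (_∸ e) n≡e+e′) (ℕₚ.m+n∸m≡n e e′)))))))

mon-neg : ∀ c e → mon (- c) e ≐ ⊝ mon c e
mon-neg c e n with n ≡ᵇ e
... | true  = refl
... | false = refl

mon-sgn-suc : ∀ k e → mon (sgn (suc k)) e ≐ ⊝ mon (sgn k) e
mon-sgn-suc k e = ≐-trans (≡⇒≐ (cong (λ c → mon c e) (ℤₚ.-1*i≡-i (sgn k)))) (mon-neg (sgn k) e)

mon-*ˡ : ∀ c d e → mon (c ℤ.* d) e ≐ cst c ⊛ mon d e
mon-*ˡ c d e = ≐-sym (≐-trans (⊛-cong (≐-sym (mon-zero c)) (≐-refl {mon d e})) (mon-⊛-mon c d 0 e))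

inv-≐[<] : ∀ {N} f g → f 0 ≡ + 1 → g 0 ≡ + 1 → f ≐[< N ] g → inv f ≐[< N ] inv g
inv-≐[<] {N} f g f₀≡1 g₀≡1 f≐g = ≐[<]-trans (≐⇒≐[<] N (≐-sym expand))
  (≐[<]-trans (⊛-cong-≐[<] {N} {inv f} {inv f} (λ _ _ → refl)
                            (⊛-cong-≐[<] {N} {g} {f} {inv g} {inv g} (≐[<]-sym f≐g) (λ _ _ → refl)))
              (≐⇒≐[<] N contract))
  where
  expand : inv f ⊛ (g ⊛ inv g) ≐ inv f
  expand = ≐-trans (⊛-cong (≐-refl {inv f}) (⊛-inverseʳ g g₀≡1)) (⊛-identityʳ (inv f))
  contract : inv f ⊛ (f ⊛ inv g) ≐ inv g
  contract = ≐-trans (solve 3 (λ a b c → a :* (b :* c) := (b :* a) :* c) ≐-refl (inv f) f (inv g))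
                     (≐-trans (⊛-cong (⊛-inverseʳ f f₀≡1) (≐-refl {inv g})) (⊛-identityˡ (inv g)))

factor : ℤ → ℕ → PS
factor c e = cst (+ 1) ⊖ mon c e

factor-constant-one : ∀ c {e} → 1 ≤ e → factor c e 0 ≡ + 1
factor-constant-one c 1≤e rewrite mon-≢ c (ℕₚ.<⇒≢ 1≤e) = refl

factor-≐ : ∀ c e → factor c e ≐ 1ₛ ⊕ ⊝ (cst c ⊛ mon (+ 1) e)
factor-≐ c e n = cong (λ m → cst (+ 1) n ℤ.- m)
  (trans (cong (λ c′ → mon c′ e n) (sym (ℤₚ.*-identityʳ c))) (mon-*ˡ c (+ 1) e n))

prodTo-constant-one : ∀ n (t : ℕ → PS) → (∀ i → t i 0 ≡ + 1) → prodTo n t 0 ≡ + 1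
prodTo-constant-one zero    t t₀≡1 = refl
prodTo-constant-one (suc n) t t₀≡1 =
  ⊛-constant-one {prodTo n t} {t n} (prodTo-constant-one n t t₀≡1) (t₀≡1 n)

poch-constant-one : ∀ c {m} d n → 1 ≤ m → poch c m d n 0 ≡ + 1
poch-constant-one c {m} d n 1≤m = prodTo-constant-one n _
  (λ i → factor-constant-one c (ℕₚ.≤-trans 1≤m (ℕₚ.m≤m+n m (d * i))))

pochInf-constant-one : ∀ c {m} d → 1 ≤ m → pochInf c m d 0 ≡ + 1
pochInf-constant-one c d = poch-constant-one c d 1

prodTo-cong : ∀ n {s t : ℕ → PS} → (∀ i → s i ≐ t i) → prodTo n s ≐ prodTo n t
prodTo-cong zero    s≐t = ≐-refl
prodTo-cong (suc n) s≐t = ⊛-cong (prodTo-cong n s≐t) (s≐t n)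

prodTo-⊛ : ∀ n (s t : ℕ → PS) → prodTo n (λ i → s i ⊛ t i) ≐ prodTo n s ⊛ prodTo n t
prodTo-⊛ zero    s t = ≐-sym (⊛-identityˡ 1ₛ)
prodTo-⊛ (suc n) s t = ≐-trans (⊛-cong (prodTo-⊛ n s t) (≐-refl {s n ⊛ t n}))
  (solve 4 (λ a b c d → (a :* b) :* (c :* d) := (a :* c) :* (b :* d)) ≐-refl
         (prodTo n s) (prodTo n t) (s n) (t n))

factor-cong : ∀ c {e e′} → e ≡ e′ → factor c e ≐ factor c e′
factor-cong c refl = ≐-refl

⊛-factor-≐[<] : ∀ f c e → f ≐[< e ] f ⊛ factor c e
⊛-factor-≐[<] f c e n n<e = sym (begin
  (f ⊛ factor c e) n           ≡⟨ expand n ⟩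
  f n ℤ.+ - (f ⊛ mon c e) n    ≡⟨ cong (λ m → f n ℤ.+ - m) (⊛-vanishingʳ f (mon-vanishing c e) n n<e) ⟩
  f n ℤ.+ - + 0                ≡⟨ ℤₚ.+-identityʳ (f n) ⟩
  f n                          ∎)
  where
  open ≡-Reasoning
  expand : f ⊛ factor c e ≐ f ⊕ ⊝ (f ⊛ mon c e)
  expand = solve 2 (λ a b → a :* (con (+ 1) :- b) := a :- a :* b) ≐-refl f (mon c e)

mon-⊛-factor : ∀ E e h → mon (+ 1) E ⊛ (factor (+ 1) e ⊛ h) ≐ mon (+ 1) E ⊛ h ⊖ mon (+ 1) (E + e) ⊛ h
mon-⊛-factor E e h = begin
  mon (+ 1) E ⊛ (factor (+ 1) e ⊛ h)
    ≈⟨ ⊛-cong (≐-refl {mon (+ 1) E}) (⊛-cong (factor-≐ (+ 1) e) (≐-refl {h})) ⟩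
  mon (+ 1) E ⊛ ((1ₛ ⊕ ⊝ (cst (+ 1) ⊛ mon (+ 1) e)) ⊛ h)
    ≈⟨ solve 3 (λ a x h → a :* ((con (+ 1) :- con (+ 1) :* x) :* h) := a :* h :- (a :* x) :* h) ≐-refl
               (mon (+ 1) E) (mon (+ 1) e) h ⟩
  mon (+ 1) E ⊛ h ⊖ (mon (+ 1) E ⊛ mon (+ 1) e) ⊛ h
    ≈⟨ ⊖-cong (≐-refl {mon (+ 1) E ⊛ h}) (⊛-cong (mon-⊛-mon (+ 1) (+ 1) E e) (≐-refl {h})) ⟩
  mon (+ 1) E ⊛ h ⊖ mon (+ 1) (E + e) ⊛ h ∎
  where open ≐-Reasoning

-- Later factors of a product only change coefficients of order at least their exponent.
poch-≐[<]-poch : ∀ c m d {N N′} → N ≤ N′ → poch c m d N ≐[< m + d * N ] poch c m d N′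
poch-≐[<]-poch c m d {N} {N′} N≤N′ rewrite sym (ℕₚ.m∸n+n≡m N≤N′) = extend (N′ ∸ N)
  where
  extend : ∀ k → poch c m d N ≐[< m + d * N ] poch c m d (k + N)
  extend zero    = λ _ _ → refl
  extend (suc k) = ≐[<]-trans (extend k)
    (≐[<]-weaken (ℕₚ.+-monoʳ-≤ m (ℕₚ.*-monoʳ-≤ d (ℕₚ.m≤n+m N k)))
      (⊛-factor-≐[<] (poch c m d (k + N)) c (m + d * (k + N))))

m≤d*m : ∀ m {d} → 1 ≤ d → m ≤ d * m
m≤d*m m 1≤d = ℕₚ.m≤n*m m _ {{ℕ.>-nonZero 1≤d}}

n<m+d*[1+n] : ∀ m {d} n → 1 ≤ d → n < m + d * suc n
n<m+d*[1+n] m {d} n 1≤d = ℕₚ.≤-trans (m≤d*m (suc n) 1≤d) (ℕₚ.m≤n+m (d * suc n) m)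

pochInf-≐[<]-poch : ∀ c m {d} N → 1 ≤ d → pochInf c m d ≐[< m + d * N ] poch c m d N
pochInf-≐[<]-poch c m {d} N 1≤d n n<m+dN with suc n ℕₚ.≤? N
... | yes 1+n≤N = poch-≐[<]-poch c m d 1+n≤N n (n<m+d*[1+n] m n 1≤d)
... | no  1+n≰N = sym (poch-≐[<]-poch c m d (ℕₚ.<⇒≤ (ℕₚ.≰⇒> 1+n≰N)) n n<m+dN)

pochInf-≐[<]-poch-suc : ∀ c m {d} n → 1 ≤ d → pochInf c m d ≐[< suc n ] poch c m d (suc n)
pochInf-≐[<]-poch-suc c m n 1≤d =
  ≐[<]-weaken (n<m+d*[1+n] m n 1≤d) (pochInf-≐[<]-poch c m (suc n) 1≤d)

poch-uncons : ∀ c m d n → poch c m d (suc n) ≐ factor c m ⊛ poch c (m + d) d n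
poch-uncons c m d zero    = ≐-trans (⊛-identityˡ (factor c (m + d * 0)))
  (≐-trans (factor-cong c (first-exponent m d)) (≐-sym (⊛-identityʳ (factor c m))))
  where
  first-exponent : ∀ m d → m + d * 0 ≡ m
  first-exponent = solve-∀
poch-uncons c m d (suc n) = ≐-trans (⊛-cong (poch-uncons c m d n) (factor-cong c (next-exponent m d n)))
  (⊛-assoc (factor c m) (poch c (m + d) d n) (factor c (m + d + d * n)))
  where
  next-exponent : ∀ m d n → m + d * suc n ≡ m + d + d * n
  next-exponent = solve-∀

pochInf-uncons : ∀ c m {d} → 1 ≤ d → pochInf c m d ≐ factor c m ⊛ pochInf c (m + d) d
pochInf-uncons c m {d} 1≤d = ≐[<]-all⇒≐ λ n →
  ≐[<]-trans (≐[<]-weaken (ℕₚ.n≤1+n (suc n)) (pochInf-≐[<]-poch-suc c m (suc n) 1≤d))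
  (≐[<]-trans (≐⇒≐[<] (suc n) (poch-uncons c m d (suc n)))
  (⊛-cong-≐[<] {f = factor c m} (λ _ _ → refl)
    (≐[<]-sym (pochInf-≐[<]-poch-suc c (m + d) n 1≤d))))

-- Euler's identity (-x;x)_∞ (x;x²)_∞ = 1 for x = q^r

factor-⊛-factor : ∀ e → factor (- + 1) e ⊛ factor (+ 1) e ≐ factor (+ 1) (e + e)
factor-⊛-factor e = begin
  factor (- + 1) e ⊛ factor (+ 1) e
    ≈⟨ ⊛-cong (factor-≐ (- + 1) e) (factor-≐ (+ 1) e) ⟩
  (1ₛ ⊕ ⊝ (cst (- + 1) ⊛ x)) ⊛ (1ₛ ⊕ ⊝ (cst (+ 1) ⊛ x))
    ≈⟨ solve 1 (λ x → (con (+ 1) :- con (- + 1) :* x) :* (con (+ 1) :- con (+ 1) :* x)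
                     := con (+ 1) :- con (+ 1) :* (x :* x)) ≐-refl x ⟩
  1ₛ ⊕ ⊝ (cst (+ 1) ⊛ (x ⊛ x))
    ≈⟨ ⊕-cong (≐-refl {1ₛ}) (⊝-cong (⊛-cong (≐-refl {cst (+ 1)}) (mon-⊛-mon (+ 1) (+ 1) e e))) ⟩
  1ₛ ⊕ ⊝ (cst (+ 1) ⊛ mon (+ 1) (e + e))
    ≈⟨ factor-≐ (+ 1) (e + e) ⟨
  factor (+ 1) (e + e) ∎
  where
  open ≐-Reasoning
  x = mon (+ 1) e

poch-merge : ∀ r N → poch (- + 1) r r N ⊛ poch (+ 1) r r N ≐ poch (+ 1) (2 * r) (2 * r) N
poch-merge r N = ≐-trans (≐-sym (prodTo-⊛ N _ _)) (prodTo-cong N (λ i →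
  ≐-trans (factor-⊛-factor (r + r * i)) (factor-cong (+ 1) (doubled-exponent r i))))
  where
  doubled-exponent : ∀ r i → r + r * i + (r + r * i) ≡ 2 * r + 2 * r * i
  doubled-exponent = solve-∀

poch-split : ∀ r N → poch (+ 1) r r (N * 2) ≐ poch (+ 1) r (2 * r) N ⊛ poch (+ 1) (2 * r) (2 * r) N
poch-split r zero    = ≐-sym (⊛-identityˡ 1ₛ)
poch-split r (suc N) = ≐-trans
  (⊛-cong (⊛-cong (poch-split r N) (factor-cong (+ 1) (odd-exponent r N))) (factor-cong (+ 1) (even-exponent r N)))
  (solve 4 (λ a b x y → ((a :* b) :* x) :* y := (a :* x) :* (b :* y)) ≐-refl
    (poch (+ 1) r (2 * r) N) (poch (+ 1) (2 * r) (2 * r) N)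
    (factor (+ 1) (r + 2 * r * N)) (factor (+ 1) (2 * r + 2 * r * N)))
  where
  odd-exponent : ∀ r N → r + r * (N * 2) ≡ r + 2 * r * N
  odd-exponent = solve-∀
  even-exponent : ∀ r N → r + r * suc (N * 2) ≡ 2 * r + 2 * r * N
  even-exponent = solve-∀

1≤2*r : ∀ {r} → 1 ≤ r → 1 ≤ 2 * r
1≤2*r {r} 1≤r = ℕₚ.≤-trans 1≤r (ℕₚ.m≤m+n r (r + 0))

pochInf-merge : ∀ r → 1 ≤ r →
  pochInf (- + 1) r r ⊛ pochInf (+ 1) r r ≐ pochInf (+ 1) (2 * r) (2 * r)
pochInf-merge r 1≤r = ≐[<]-all⇒≐ λ n →
  ≐[<]-trans (⊛-cong-≐[<] (pochInf-≐[<]-poch-suc (- + 1) r n 1≤r) (pochInf-≐[<]-poch-suc (+ 1) r n 1≤r))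
  (≐[<]-trans (≐⇒≐[<] (suc n) (poch-merge r (suc n)))
              (≐[<]-sym (pochInf-≐[<]-poch-suc (+ 1) (2 * r) n (1≤2*r 1≤r))))

pochInf-split : ∀ r → 1 ≤ r →
  pochInf (+ 1) r r ≐ pochInf (+ 1) r (2 * r) ⊛ pochInf (+ 1) (2 * r) (2 * r)
pochInf-split r 1≤r = ≐[<]-all⇒≐ λ n →
  ≐[<]-trans (≐[<]-weaken (1+n≤ n) (pochInf-≐[<]-poch (+ 1) r (suc n * 2) 1≤r))
  (≐[<]-trans (≐⇒≐[<] (suc n) (poch-split r (suc n)))
  (≐[<]-sym (⊛-cong-≐[<] (pochInf-≐[<]-poch-suc (+ 1) r n (1≤2*r 1≤r))
                         (pochInf-≐[<]-poch-suc (+ 1) (2 * r) n (1≤2*r 1≤r)))))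
  where
  1+n≤ : ∀ n → suc n ≤ r + r * (suc n * 2)
  1+n≤ n = ℕₚ.≤-trans (ℕₚ.m≤m*n (suc n) 2) (ℕₚ.≤-trans (m≤d*m (suc n * 2) 1≤r) (ℕₚ.m≤n+m _ r))

euler : ∀ r → 1 ≤ r → pochInf (- + 1) r r ⊛ pochInf (+ 1) r (2 * r) ≐ 1ₛ
euler r 1≤r = begin
  Y ⊛ Z                     ≈⟨ ⊛-identityʳ (Y ⊛ Z) ⟨
  (Y ⊛ Z) ⊛ 1ₛ              ≈⟨ ⊛-cong (≐-refl {Y ⊛ Z}) (⊛-inverseʳ P P₀≡1) ⟨
  (Y ⊛ Z) ⊛ (P ⊛ inv P)     ≈⟨ solve 4 (λ y z p i → (y :* z) :* (p :* i) := (y :* (z :* p)) :* i) ≐-refl Y Z P (inv P) ⟩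
  (Y ⊛ (Z ⊛ P)) ⊛ inv P     ≈⟨ ⊛-cong (⊛-cong (≐-refl {Y}) (pochInf-split r 1≤r)) (≐-refl {inv P}) ⟨
  (Y ⊛ X) ⊛ inv P           ≈⟨ ⊛-cong (pochInf-merge r 1≤r) (≐-refl {inv P}) ⟩
  P ⊛ inv P                 ≈⟨ ⊛-inverseʳ P P₀≡1 ⟩
  1ₛ                        ∎
  where
  open ≐-Reasoning
  X = pochInf (+ 1) r r
  Y = pochInf (- + 1) r r
  Z = pochInf (+ 1) r (2 * r)
  P = pochInf (+ 1) (2 * r) (2 * r)
  P₀≡1 : P 0 ≡ + 1
  P₀≡1 = pochInf-constant-one (+ 1) (2 * r) (1≤2*r 1≤r)

Summable : (ℕ → PS) → Set
Summable t = ∀ j → t j ≐[< j ] 0ₛ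

sumTo-coefficient : ∀ m t n → sumTo m t n ≡ Σℤ m (λ j → t j n)
sumTo-coefficient zero    t zero    = refl
sumTo-coefficient zero    t (suc n) = refl
sumTo-coefficient (suc m) t n       = cong (ℤ._+ t m n) (sumTo-coefficient m t n)

sumInf-coefficient : ∀ {t} → Summable t → ∀ {n M} → n < M → sumInf t n ≡ Σℤ M (λ j → t j n)
sumInf-coefficient {t} summable {n} {M} n<M = begin
  sumInf t n                                  ≡⟨ sumTo-coefficient (suc n) t n ⟩
  Σℤ (suc n) (λ j → t j n)                    ≡⟨ Σℤ-extend (suc n) (M ∸ suc n) _ (λ j n<j → summable j n n<j) ⟨
  Σℤ (M ∸ suc n + suc n) (λ j → t j n)        ≡⟨ cong (λ k → Σℤ k (λ j → t j n)) (ℕₚ.m∸n+n≡m n<M) ⟩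
  Σℤ M (λ j → t j n)                          ∎
  where open ≡-Reasoning

sumInf-uncons : ∀ {t} → Summable t → sumInf t ≐ t 0 ⊕ sumInf (t ∘ suc)
sumInf-uncons {t} summable n = begin
  sumInf t n                          ≡⟨ sumInf-coefficient summable (ℕₚ.n≤1+n (suc n)) ⟩
  Σℤ (suc (suc n)) (λ j → t j n)      ≡⟨ Σℤ-head (suc n) (λ j → t j n) ⟩
  t 0 n ℤ.+ Σℤ (suc n) (λ j → t (suc j) n)
    ≡⟨ cong (λ s → t 0 n ℤ.+ s) (sumTo-coefficient (suc n) (t ∘ suc) n) ⟨
  t 0 n ℤ.+ sumInf (t ∘ suc) n        ∎
  where open ≡-Reasoning

sumInf-cong : ∀ {t u} → (∀ j → t j ≐ u j) → sumInf t ≐ sumInf u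
sumInf-cong {t} {u} t≐u n = begin
  sumInf t n                 ≡⟨ sumTo-coefficient (suc n) t n ⟩
  Σℤ (suc n) (λ j → t j n)   ≡⟨ Σℤ-cong (suc n) (λ j → t≐u j n) ⟩
  Σℤ (suc n) (λ j → u j n)   ≡⟨ sumTo-coefficient (suc n) u n ⟨
  sumInf u n                 ∎
  where open ≡-Reasoning

sumInf-⊖ : ∀ t u → sumInf (λ j → t j ⊖ u j) ≐ sumInf t ⊖ sumInf u
sumInf-⊖ t u n = begin
  sumInf (λ j → t j ⊖ u j) n                          ≡⟨ sumTo-coefficient (suc n) _ n ⟩
  Σℤ (suc n) (λ j → t j n ℤ.+ - u j n)                ≡⟨ Σℤ-+ (suc n) _ _ ⟩
  Σℤ (suc n) (λ j → t j n) ℤ.+ Σℤ (suc n) (λ j → - u j n)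
    ≡⟨ cong₂ (λ a b → a ℤ.+ b) (sym (sumTo-coefficient (suc n) t n))
             (trans (sym (Σℤ-neg (suc n) _)) (cong -_ (sym (sumTo-coefficient (suc n) u n)))) ⟩
  sumInf t n ℤ.- sumInf u n                           ∎
  where open ≡-Reasoning

⊛-sumInf : ∀ f {t} → Summable t → f ⊛ sumInf t ≐ sumInf (λ j → f ⊛ t j)
⊛-sumInf f {t} summable n = begin
  Σℤ (suc n) (λ i → f i ℤ.* sumInf t (n ∸ i))
    ≡⟨ Σℤ-cong< (suc n) (λ i i≤n → cong (f i ℤ.*_) (sumInf-coefficient summable (s≤s (ℕₚ.m∸n≤m n i)))) ⟩
  Σℤ (suc n) (λ i → f i ℤ.* Σℤ (suc n) (λ j → t j (n ∸ i)))
    ≡⟨ Σℤ-cong (suc n) (λ i → Σℤ-*ˡ (suc n) (f i) _) ⟩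
  Σℤ (suc n) (λ i → Σℤ (suc n) (λ j → f i ℤ.* t j (n ∸ i)))
    ≡⟨ Σℤ-swap (suc n) (suc n) _ ⟩
  Σℤ (suc n) (λ j → (f ⊛ t j) n)
    ≡⟨ sumTo-coefficient (suc n) _ n ⟨
  sumInf (λ j → f ⊛ t j) n ∎
  where open ≡-Reasoning

sumInf-vanishing : ∀ {N} t → (∀ j → t j ≐[< N ] 0ₛ) → sumInf t ≐[< N ] 0ₛ
sumInf-vanishing t t≐0 n n<N =
  trans (sumTo-coefficient (suc n) t n) (Σℤ-zero (suc n) (λ j _ → t≐0 j n n<N))

-- The sums G b s

quadExp : ℕ → ℕ → ℕ
quadExp b zero    = 0
quadExp b (suc i) = (2 * b + 2 * i + 1) * suc i

b≤quadExp : ∀ b i → b ≤ quadExp b (suc i)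
b≤quadExp b i = ℕₚ.≤-trans (ℕₚ.m≤m+n b (b + 0))
  (ℕₚ.≤-trans (ℕₚ.m≤m+n (2 * b) (2 * i)) (ℕₚ.≤-trans (ℕₚ.m≤m+n _ 1) (ℕₚ.m≤m*n _ (suc i))))

j≤quadExp : ∀ b j → j ≤ quadExp b j
j≤quadExp b zero    = z≤n
j≤quadExp b (suc i) = ℕₚ.m≤n*m (suc i) (2 * b + 2 * i + 1) {{nonZero}}
  where nonZero = subst ℕ.NonZero (ℕₚ.+-comm 1 (2 * b + 2 * i)) _

quadExp-oddStep : ∀ r b s j →
  r * quadExp b j + (r + 2 * r * (s + j)) ≡ r * (2 * s + 1) + r * quadExp (suc b) j
quadExp-oddStep r b s zero    = lemma r s
  where
  lemma : ∀ r s → r * 0 + (r + 2 * r * (s + 0)) ≡ r * (2 * s + 1) + r * 0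
  lemma = solve-∀
quadExp-oddStep r b s (suc i) = lemma r s b i
  where
  lemma : ∀ r s b i → r * ((2 * b + 2 * i + 1) * suc i) + (r + 2 * r * (s + suc i))
                    ≡ r * (2 * s + 1) + r * ((2 * suc b + 2 * i + 1) * suc i)
  lemma = solve-∀

quadExp-evenStep : ∀ r b i → r * quadExp (suc b) (suc i) ≡ r * quadExp b (suc i) + (2 * r + 2 * r * i)
quadExp-evenStep r b i = lemma r b i
  where
  lemma : ∀ r b i → r * ((2 * suc b + 2 * i + 1) * suc i)
                  ≡ r * ((2 * b + 2 * i + 1) * suc i) + (2 * r + 2 * r * i)
  lemma = solve-∀

quadExp-lower : ∀ r b i → r * quadExp b (suc i) ≡ r * (2 * b + 1) + r * quadExp (suc (suc b)) i
quadExp-lower r b zero    = lemma r b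
  where
  lemma : ∀ r b → r * ((2 * b + 2 * 0 + 1) * 1) ≡ r * (2 * b + 1) + r * 0
  lemma = solve-∀
quadExp-lower r b (suc i) = lemma r b i
  where
  lemma : ∀ r b i → r * ((2 * b + 2 * suc i + 1) * suc (suc i))
                  ≡ r * (2 * b + 1) + r * ((2 * suc (suc b) + 2 * i + 1) * suc i)
  lemma = solve-∀

quadExp-as-stated : ∀ r k j → (2 * k + 2 * j + 3) * r * j ≡ r * quadExp (suc (suc k)) j
quadExp-as-stated r k zero    = lemma k r
  where
  lemma : ∀ k r → (2 * k + 2 * 0 + 3) * r * 0 ≡ r * 0
  lemma = solve-∀
quadExp-as-stated r k (suc i) = lemma k r i
  where
  lemma : ∀ k r i → (2 * k + 2 * suc i + 3) * r * suc i ≡ r * ((2 * suc (suc k) + 2 * i + 1) * suc i)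
  lemma = solve-∀

-- x stands for q^r; evenPoch and oddPoch are (x²;x²)_n and (x;x²)_n, so that
-- G b s = Σ_j x^{j(2b+2j-1)} / ((x²;x²)_j (x;x²)_{s+j}).
module _ (r : ℕ) (1≤r : 1 ≤ r) where

  x^ : ℕ → PS
  x^ e = mon (+ 1) (r * e)

  evenPoch oddPoch : ℕ → PS
  evenPoch = poch (+ 1) (2 * r) (2 * r)
  oddPoch  = poch (+ 1) r (2 * r)

  oddPoch∞ : PS
  oddPoch∞ = pochInf (+ 1) r (2 * r)

  summand : ℕ → ℕ → ℕ → PS
  summand E j c = mon (+ 1) E ⊛ inv (evenPoch j ⊛ oddPoch c)

  G-term : ℕ → ℕ → ℕ → PS
  G-term b s j = summand (r * quadExp b j) j (s + j)

  G : ℕ → ℕ → PS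
  G b s = sumInf (G-term b s)

  oddPoch-constant-one : ∀ c → oddPoch c 0 ≡ + 1
  oddPoch-constant-one c = poch-constant-one (+ 1) (2 * r) c 1≤r

  evenOdd-constant-one : ∀ j c → (evenPoch j ⊛ oddPoch c) 0 ≡ + 1
  evenOdd-constant-one j c =
    ⊛-constant-one {evenPoch j} {oddPoch c} (poch-constant-one (+ 1) (2 * r) j (1≤2*r 1≤r))
                                            (oddPoch-constant-one c)

  factor-constant-one-r : ∀ {e} → r ≤ e → factor (+ 1) e 0 ≡ + 1
  factor-constant-one-r r≤e = factor-constant-one (+ 1) (ℕₚ.≤-trans 1≤r r≤e)

  summand-vanishing : ∀ E j c → summand E j c ≐[< E ] 0ₛ
  summand-vanishing E j c = ≐[<]-trans (≐⇒≐[<] E (⊛-comm (mon (+ 1) E) (inv (evenPoch j ⊛ oddPoch c))))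
    (⊛-vanishingʳ (inv (evenPoch j ⊛ oddPoch c)) (mon-vanishing (+ 1) E))

  G-term-summable : ∀ b s → Summable (G-term b s)
  G-term-summable b s j = ≐[<]-weaken (ℕₚ.≤-trans (j≤quadExp b j) (m≤d*m (quadExp b j) 1≤r))
    (summand-vanishing (r * quadExp b j) j (s + j))

  summand-shift : ∀ A B j c → summand (A + B) j c ≐ mon (+ 1) A ⊛ summand B j c
  summand-shift A B j c = ≐-trans
    (⊛-cong (≐-sym (mon-⊛-mon (+ 1) (+ 1) A B)) (≐-refl {inv (evenPoch j ⊛ oddPoch c)}))
    (⊛-assoc (mon (+ 1) A) (mon (+ 1) B) (inv (evenPoch j ⊛ oddPoch c)))

  summand-oddStep : ∀ E j c →
    summand E j c ≐ summand E j (suc c) ⊖ summand (E + (r + 2 * r * c)) j (suc c)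
  summand-oddStep E j c = ≐-trans
    (⊛-cong (≐-refl {mon (+ 1) E}) (≐-sym (inv-⊛-cancelʳ (evenPoch j ⊛ oddPoch c) (factor (+ 1) e)
      (evenPoch j ⊛ oddPoch (suc c)) (evenOdd-constant-one j c) (factor-constant-one-r (ℕₚ.m≤m+n r _))
      (≐-sym (⊛-assoc (evenPoch j) (oddPoch c) (factor (+ 1) e))))))
    (mon-⊛-factor E e (inv (evenPoch j ⊛ oddPoch (suc c))))
    where e = r + 2 * r * c

  summand-evenStep : ∀ E i c →
    summand E (suc i) c ⊖ summand (E + (2 * r + 2 * r * i)) (suc i) c ≐ summand E i c
  summand-evenStep E i c = ≐-trans
    (≐-sym (mon-⊛-factor E e (inv (evenPoch (suc i) ⊛ oddPoch c))))
    (⊛-cong (≐-refl {mon (+ 1) E}) (inv-⊛-cancelʳ (evenPoch i ⊛ oddPoch c) (factor (+ 1) e)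
      (evenPoch (suc i) ⊛ oddPoch c) (evenOdd-constant-one i c)
      (factor-constant-one-r (ℕₚ.≤-trans (ℕₚ.m≤m+n r (r + 0)) (ℕₚ.m≤m+n (2 * r) _)))
      (solve 3 (λ a b c → (a :* b) :* c := (a :* c) :* b) ≐-refl (evenPoch i) (factor (+ 1) e) (oddPoch c))))
    where e = 2 * r + 2 * r * i

  G-oddStep : ∀ b s → G b s ≐ G b (suc s) ⊖ x^ (2 * s + 1) ⊛ G (suc b) (suc s)
  G-oddStep b s = ≐-trans (sumInf-cong termwise) (≐-trans (sumInf-⊖ _ _)
    (⊖-cong (≐-refl {G b (suc s)})
            (≐-sym (⊛-sumInf (x^ (2 * s + 1)) (G-term-summable (suc b) (suc s))))))
    where
    termwise : ∀ j → G-term b s j ≐ G-term b (suc s) j ⊖ x^ (2 * s + 1) ⊛ G-term (suc b) (suc s) j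
    termwise j = ≐-trans (summand-oddStep (r * quadExp b j) j (s + j))
      (⊖-cong (≐-refl {G-term b (suc s) j})
        (≐-trans (≡⇒≐ (cong (λ E → summand E j (suc s + j)) (quadExp-oddStep r b s j)))
                 (summand-shift (r * (2 * s + 1)) (r * quadExp (suc b) j) j (suc s + j))))

  G-evenStep : ∀ b s → G b s ⊖ G (suc b) s ≐ x^ (2 * b + 1) ⊛ G (suc (suc b)) (suc s)
  G-evenStep b s = begin
    G b s ⊖ G (suc b) s
      ≈⟨ sumInf-⊖ (t b) (t (suc b)) ⟨
    sumInf (λ j → t b j ⊖ t (suc b) j)
      ≈⟨ sumInf-uncons {λ j → t b j ⊖ t (suc b) j} difference-summable ⟩
    (t b 0 ⊖ t (suc b) 0) ⊕ sumInf (λ i → t b (suc i) ⊖ t (suc b) (suc i))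
      ≈⟨ ⊕-cong {g = sumInf (λ i → t b (suc i) ⊖ t (suc b) (suc i))}
                (λ n → ℤₚ.+-inverseʳ (t b 0 n)) (sumInf-cong tail) ⟩
    0ₛ ⊕ sumInf (λ i → x^ (2 * b + 1) ⊛ G-term (suc (suc b)) (suc s) i)
      ≈⟨ (λ n → ℤₚ.+-identityˡ _) ⟩
    sumInf (λ i → x^ (2 * b + 1) ⊛ G-term (suc (suc b)) (suc s) i)
      ≈⟨ ⊛-sumInf (x^ (2 * b + 1)) (G-term-summable (suc (suc b)) (suc s)) ⟨
    x^ (2 * b + 1) ⊛ G (suc (suc b)) (suc s) ∎
    where
    open ≐-Reasoning
    t = λ b → G-term b s
    difference-summable : Summable (λ j → t b j ⊖ t (suc b) j)
    difference-summable j n n<j =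
      cong₂ ℤ._-_ (G-term-summable b s j n n<j) (G-term-summable (suc b) s j n n<j)
    tail : ∀ i → t b (suc i) ⊖ t (suc b) (suc i) ≐ x^ (2 * b + 1) ⊛ G-term (suc (suc b)) (suc s) i
    tail i = begin
      t b (suc i) ⊖ t (suc b) (suc i)
        ≈⟨ ⊖-cong (≐-refl {t b (suc i)})
                  (≡⇒≐ (cong (λ E → summand E (suc i) (s + suc i)) (quadExp-evenStep r b i))) ⟩
      summand E (suc i) (s + suc i) ⊖ summand (E + (2 * r + 2 * r * i)) (suc i) (s + suc i)
        ≈⟨ summand-evenStep E i (s + suc i) ⟩
      summand E i (s + suc i)
        ≈⟨ ≡⇒≐ (cong₂ (λ E c → summand E i c) (quadExp-lower r b i) (ℕₚ.+-suc s i)) ⟩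
      summand (r * (2 * b + 1) + r * quadExp (suc (suc b)) i) i (suc s + i)
        ≈⟨ summand-shift (r * (2 * b + 1)) (r * quadExp (suc (suc b)) i) i (suc s + i) ⟩
      x^ (2 * b + 1) ⊛ G-term (suc (suc b)) (suc s) i ∎
      where E = r * quadExp b (suc i)

  x^-+ : ∀ a b → x^ a ⊛ x^ b ≐ x^ (a + b)
  x^-+ a b = ≐-trans (mon-⊛-mon (+ 1) (+ 1) (r * a) (r * b))
    (≡⇒≐ (cong (mon (+ 1)) (sym (ℕₚ.*-distribˡ-+ r a b))))

  x^-vanishing : ∀ e → x^ e ≐[< e ] 0ₛ
  x^-vanishing e = ≐[<]-weaken (m≤d*m e 1≤r) (mon-vanishing (+ 1) (r * e))

  oddPoch∞-constant-one : oddPoch∞ 0 ≡ + 1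
  oddPoch∞-constant-one = pochInf-constant-one (+ 1) (2 * r) 1≤r

  G-≐[<]-inv-oddPoch : ∀ b s → G b s ≐[< r * b ] inv (oddPoch s)
  G-≐[<]-inv-oddPoch b s n n<rb = begin
    G b s n                                          ≡⟨ sumInf-uncons (G-term-summable b s) n ⟩
    G-term b s 0 n ℤ.+ sumInf (G-term b s ∘ suc) n   ≡⟨ cong₂ ℤ._+_ (head n) (sumInf-vanishing _ tail n n<rb) ⟩
    inv (oddPoch s) n ℤ.+ + 0                        ≡⟨ ℤₚ.+-identityʳ _ ⟩
    inv (oddPoch s) n                                ∎
    where
    open ≡-Reasoning
    head : G-term b s 0 ≐ inv (oddPoch s)
    head = ≐-trans (≡⇒≐ (cong₂ (λ E c → summand E 0 c) (ℕₚ.*-zeroʳ r) (ℕₚ.+-identityʳ s)))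
      (≐-trans (⊛-cong (mon-zero (+ 1)) (inv-cong (evenOdd-constant-one 0 s) (⊛-identityˡ (oddPoch s))))
               (⊛-identityˡ (inv (oddPoch s))))
    tail : ∀ i → G-term b s (suc i) ≐[< r * b ] 0ₛ
    tail i = ≐[<]-weaken (ℕₚ.*-monoʳ-≤ r (b≤quadExp b i)) (summand-vanishing _ (suc i) (s + suc i))

  G-diagonal-step : ∀ b → G b b ⊖ G (suc b) (suc b) ≐
    ⊝ x^ (2 * b + 1) ⊛ (G (suc b) (suc b) ⊖ G (suc (suc b)) (suc (suc b)))
  G-diagonal-step b = begin
    G b b ⊖ V₁                  ≈⟨ ⊖-cong (G-oddStep b b) (≐-refl {V₁}) ⟩
    A ⊖ q ⊛ V₁ ⊖ V₁             ≈⟨ solve 3 (λ a q v → a :- q :* v :- v := (a :- v) :- q :* v) ≐-refl A q V₁ ⟩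
    (A ⊖ V₁) ⊖ q ⊛ V₁           ≈⟨ ⊖-cong (G-evenStep b (suc b)) (≐-refl {q ⊛ V₁}) ⟩
    q ⊛ V₂ ⊖ q ⊛ V₁             ≈⟨ solve 3 (λ q v w → q :* w :- q :* v := (:- q) :* (v :- w)) ≐-refl q V₁ V₂ ⟩
    ⊝ q ⊛ (V₁ ⊖ V₂)             ∎
    where
    open ≐-Reasoning
    A  = G b (suc b)
    V₁ = G (suc b) (suc b)
    V₂ = G (suc (suc b)) (suc (suc b))
    q  = x^ (2 * b + 1)

  G-diagonal-suc : ∀ b → G b b ≐ G (suc b) (suc b)
  G-diagonal-suc b = ⊖≐0⇒≐ (≐0-by-contraction (λ b → G b b ⊖ G (suc b) (suc b)) (λ b → ⊝ x^ (2 * b + 1))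
    ⊝x^-vanishing G-diagonal-step b)
    where
    ⊝x^-vanishing : ∀ b → ⊝ x^ (2 * b + 1) ≐[< 1 ] 0ₛ
    ⊝x^-vanishing b n n<1 = cong -_ (x^-vanishing (2 * b + 1) n (ℕₚ.<-≤-trans n<1 (ℕₚ.m≤n+m 1 (2 * b))))

  G-diagonal-constant : ∀ k b → G b b ≐ G (k + b) (k + b)
  G-diagonal-constant zero    b = ≐-refl
  G-diagonal-constant (suc k) b = ≐-trans (G-diagonal-constant k b) (G-diagonal-suc (k + b))

  G-diagonal : ∀ b → G b b ≐ inv oddPoch∞
  G-diagonal b n = begin
    G b b n              ≡⟨ G-diagonal-constant (suc n) b n ⟩
    G c c n              ≡⟨ G-≐[<]-inv-oddPoch c c n n<rc ⟩
    inv (oddPoch c) n    ≡⟨ inv-≐[<] (oddPoch c) oddPoch∞ (oddPoch-constant-one c) oddPoch∞-constant-one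
                              (≐[<]-sym (pochInf-≐[<]-poch (+ 1) r c (1≤2*r 1≤r))) n n<r+2rc ⟩
    inv oddPoch∞ n       ∎
    where
    open ≡-Reasoning
    c = suc n + b
    n<rc : n < r * c
    n<rc = ℕₚ.<-≤-trans (ℕₚ.m≤m+n (suc n) b) (m≤d*m c 1≤r)
    n<r+2rc : n < r + 2 * r * c
    n<r+2rc = ℕₚ.<-≤-trans n<rc (ℕₚ.≤-trans (ℕₚ.*-monoˡ-≤ c (ℕₚ.m≤m+n r (r + 0))) (ℕₚ.m≤n+m _ r))

  F : ℕ → PS
  F a = oddPoch∞ ⊛ G (suc a) a

  F-step : ∀ a → F a ≐ 1ₛ ⊖ x^ (2 * a + 1) ⊛ F (suc a)
  F-step a = begin
    Z ⊛ G (suc a) a         ≈⟨ ⊛-cong (≐-refl {Z}) (G-oddStep (suc a) a) ⟩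
    Z ⊛ (V ⊖ q ⊛ W)         ≈⟨ solve 4 (λ z v q w → z :* (v :- q :* w) := z :* v :- q :* (z :* w)) ≐-refl Z V q W ⟩
    Z ⊛ V ⊖ q ⊛ (Z ⊛ W)     ≈⟨ ⊖-cong (≐-trans (⊛-cong (≐-refl {Z}) (G-diagonal (suc a)))
                                                (⊛-inverseʳ Z oddPoch∞-constant-one))
                                       (≐-refl {q ⊛ (Z ⊛ W)}) ⟩
    1ₛ ⊖ q ⊛ F (suc a)      ∎
    where
    open ≐-Reasoning
    Z = oddPoch∞
    V = G (suc a) (suc a)
    W = G (suc (suc a)) (suc a)
    q = x^ (2 * a + 1)

  H : ℕ → PS
  H c = G c 0 ⊖ x^ c ⊛ G (suc c) 1

  H-step : ∀ c → H c ≐ factor (+ 1) (r * c) ⊛ H (suc c)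
  H-step c = begin
    a ⊖ x ⊛ d
      ≈⟨ solve 5 (λ a b d u x → a :- x :* d := (a :- b) :+ b :- x :* ((d :- u) :+ u)) ≐-refl a b d (y ⊛ e) x ⟩
    (a ⊖ b) ⊕ b ⊖ x ⊛ ((d ⊖ y ⊛ e) ⊕ y ⊛ e)
      ≈⟨ ⊖-cong (⊕-cong (≐-trans (G-evenStep c 0) (⊛-cong x^[2c+1] (≐-refl {e}))) (≐-refl {b}))
                (⊛-cong (≐-refl {x}) (⊕-cong (≐-sym (G-oddStep (suc c) 0)) (≐-refl {y ⊛ e}))) ⟩
    ((x ⊛ x) ⊛ y) ⊛ e ⊕ b ⊖ x ⊛ (b ⊕ y ⊛ e)
      ≈⟨ solve 4 (λ b x y e → ((x :* x) :* y) :* e :+ b :- x :* (b :+ y :* e)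
                              := (con (+ 1) :- con (+ 1) :* x) :* (b :- (x :* y) :* e)) ≐-refl b x y e ⟩
    (1ₛ ⊕ ⊝ (cst (+ 1) ⊛ x)) ⊛ (b ⊖ (x ⊛ y) ⊛ e)
      ≈⟨ ⊛-cong (≐-sym (factor-≐ (+ 1) (r * c)))
                (⊖-cong (≐-refl {b})
                        (⊛-cong (≐-trans (x^-+ c 1) (≡⇒≐ (cong x^ (ℕₚ.+-comm c 1)))) (≐-refl {e}))) ⟩
    factor (+ 1) (r * c) ⊛ H (suc c) ∎
    where
    open ≐-Reasoning
    a = G c 0
    b = G (suc c) 0
    d = G (suc c) 1
    e = G (suc (suc c)) 1
    x = x^ c
    y = x^ 1
    x^[2c+1] : x^ (2 * c + 1) ≐ (x ⊛ x) ⊛ y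
    x^[2c+1] = ≐-sym (≐-trans (⊛-cong (x^-+ c c) (≐-refl {y}))
      (≐-trans (x^-+ (c + c) 1) (≡⇒≐ (cong x^ (double c)))))
      where
      double : ∀ c → c + c + 1 ≡ 2 * c + 1
      double = solve-∀

  H-≐[<]-1ₛ : ∀ c → H c ≐[< r * c ] 1ₛ
  H-≐[<]-1ₛ c n n<rc = begin
    G c 0 n ℤ.- (x^ c ⊛ G (suc c) 1) n   ≡⟨ cong₂ ℤ._-_ (G-≐[<]-inv-oddPoch c 0 n n<rc)
                                             (⊛-vanishingˡ (G (suc c) 1) (mon-vanishing (+ 1) (r * c)) n n<rc) ⟩
    inv 1ₛ n ℤ.- + 0                      ≡⟨ ℤₚ.+-identityʳ (inv 1ₛ n) ⟩
    inv 1ₛ n                              ≡⟨ inv-1ₛ n ⟩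
    1ₛ n                                  ∎
    where open ≡-Reasoning

  H≐pochInf : ∀ c → H c ≐ pochInf (+ 1) (r * c) r
  H≐pochInf c = ⊖≐0⇒≐ (≐0-by-recurrence (λ c → H c ⊖ P c) (λ c → factor (+ 1) (r * c)) step vanishing c)
    where
    P = λ c → pochInf (+ 1) (r * c) r
    P-step : ∀ c → P c ≐ factor (+ 1) (r * c) ⊛ P (suc c)
    P-step c = ≐-trans (pochInf-uncons (+ 1) (r * c) 1≤r)
      (⊛-cong (≐-refl {factor (+ 1) (r * c)}) (≡⇒≐ (cong (λ m → pochInf (+ 1) m r) r*c+r≡r*[1+c])))
      where r*c+r≡r*[1+c] = trans (ℕₚ.+-comm (r * c) r) (sym (ℕₚ.*-suc r c))
    step : ∀ c → H c ⊖ P c ≐ factor (+ 1) (r * c) ⊛ (H (suc c) ⊖ P (suc c))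
    step c = ≐-trans (⊖-cong (H-step c) (P-step c))
      (solve 3 (λ f h p → f :* h :- f :* p := f :* (h :- p)) ≐-refl (factor (+ 1) (r * c)) (H (suc c)) (P (suc c)))
    vanishing : ∀ c → H c ⊖ P c ≐[< c ] 0ₛ
    vanishing c n n<c = trans
      (cong₂ ℤ._-_ (H-≐[<]-1ₛ c n n<rc)
                   (pochInf-≐[<]-poch (+ 1) (r * c) 0 1≤r n (ℕₚ.<-≤-trans n<rc (ℕₚ.m≤m+n (r * c) (r * 0)))))
      (ℤₚ.+-inverseʳ (1ₛ n))
      where n<rc = ℕₚ.<-≤-trans n<c (m≤d*m c 1≤r)

  gauss : pochInf (+ 1) r r ⊛ inv (pochInf (- + 1) r r) ≐ cst (+ 2) ⊛ F 0 ⊖ 1ₛ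
  gauss = begin
    X ⊛ inv Y
      ≈⟨ ⊛-cong (≐-trans (≡⇒≐ (cong (λ m → pochInf (+ 1) m r) (sym (ℕₚ.*-identityʳ r))))
                         (≐-sym (H≐pochInf 1)))
                (≐-sym (inv-unique Y oddPoch∞ (pochInf-constant-one (- + 1) r 1≤r) (euler r 1≤r))) ⟩
    (G 1 0 ⊖ x^ 1 ⊛ G 2 1) ⊛ oddPoch∞
      ≈⟨ solve 4 (λ a q b z → (a :- q :* b) :* z := z :* a :- q :* (z :* b)) ≐-refl (G 1 0) (x^ 1) (G 2 1) oddPoch∞ ⟩
    F 0 ⊖ x^ 1 ⊛ F 1
      ≈⟨ solve 2 (λ f g → f :- g := f :+ ((con (+ 1) :- g) :- con (+ 1))) ≐-refl (F 0) (x^ 1 ⊛ F 1) ⟩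
    F 0 ⊕ ((1ₛ ⊖ x^ 1 ⊛ F 1) ⊖ 1ₛ)
      ≈⟨ ⊕-cong (≐-refl {F 0}) (⊖-cong (≐-sym (F-step 0)) (≐-refl {1ₛ})) ⟩
    F 0 ⊕ (F 0 ⊖ 1ₛ)
      ≈⟨ solve 1 (λ f → f :+ (f :- con (+ 1)) := con (+ 2) :* f :- con (+ 1)) ≐-refl (F 0) ⟩
    cst (+ 2) ⊛ F 0 ⊖ 1ₛ ∎
    where
    open ≐-Reasoning
    X = pochInf (+ 1) r r
    Y = pochInf (- + 1) r r

  signedSquare : ℕ → PS
  signedSquare k = mon (sgn k) (r * (suc k * suc k))

  signedSquares : ℕ → PS
  signedSquares k = sumTo k (λ i → mon (sgn (1 + i)) (r * ((1 + i) * (1 + i))))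

  signedSquare-step : ∀ k → signedSquare k ⊛ x^ (2 * suc k + 1) ≐ ⊝ signedSquare (suc k)
  signedSquare-step k = begin
    signedSquare k ⊛ x^ (2 * suc k + 1)
      ≈⟨ mon-⊛-mon (sgn k) (+ 1) _ _ ⟩
    mon (sgn k ℤ.* + 1) (r * (suc k * suc k) + r * (2 * suc k + 1))
      ≈⟨ ≡⇒≐ (cong₂ mon (ℤₚ.*-identityʳ (sgn k)) (next-square r k)) ⟩
    mon (sgn k) E
      ≈⟨ (λ n → ℤₚ.neg-involutive (mon (sgn k) E n)) ⟨
    ⊝ ⊝ mon (sgn k) E
      ≈⟨ ⊝-cong (mon-sgn-suc k E) ⟨
    ⊝ signedSquare (suc k) ∎
    where
    open ≐-Reasoning
    E = r * (suc (suc k) * suc (suc k))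
    next-square : ∀ r k → r * (suc k * suc k) + r * (2 * suc k + 1) ≡ r * (suc (suc k) * suc (suc k))
    next-square = solve-∀

  F-telescope : ∀ k → F 0 ≐ 1ₛ ⊕ signedSquares k ⊖ signedSquare k ⊛ F (suc k)
  F-telescope zero    = ≐-trans (F-step 0)
    (solve 2 (λ q f → con (+ 1) :- q :* f := con (+ 1) :+ con (+ 0) :- q :* f) ≐-refl (x^ 1) (F 1))
  F-telescope (suc k) = begin
    F 0
      ≈⟨ F-telescope k ⟩
    1ₛ ⊕ T ⊖ μ ⊛ F (suc k)
      ≈⟨ ⊖-cong (≐-refl {1ₛ ⊕ T}) (⊛-cong (≐-refl {μ}) (F-step (suc k))) ⟩
    1ₛ ⊕ T ⊖ μ ⊛ (1ₛ ⊖ q ⊛ F′)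
      ≈⟨ solve 4 (λ t m q f → con (+ 1) :+ t :- m :* (con (+ 1) :- q :* f)
                              := con (+ 1) :+ (t :- m) :+ (m :* q) :* f)
                 ≐-refl T μ q F′ ⟩
    1ₛ ⊕ (T ⊖ μ) ⊕ (μ ⊛ q) ⊛ F′
      ≈⟨ ⊕-cong (⊕-cong (≐-refl {1ₛ}) (⊕-cong (≐-refl {T}) (≐-sym (mon-sgn-suc k (r * (suc k * suc k))))))
                (⊛-cong (signedSquare-step k) (≐-refl {F′})) ⟩
    1ₛ ⊕ signedSquares (suc k) ⊕ (⊝ μ′) ⊛ F′
      ≈⟨ solve 3 (λ t m f → con (+ 1) :+ t :+ (:- m) :* f := con (+ 1) :+ t :- m :* f) ≐-refl
                 (signedSquares (suc k)) μ′ F′ ⟩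
    1ₛ ⊕ signedSquares (suc k) ⊖ μ′ ⊛ F′ ∎
    where
    open ≐-Reasoning
    T  = signedSquares k
    μ  = signedSquare k
    μ′ = signedSquare (suc k)
    q  = x^ (2 * suc k + 1)
    F′ = F (suc (suc k))

  gauss-truncated : ∀ k →
    pochInf (+ 1) r r ⊛ inv (pochInf (- + 1) r r) ⊕ (cst (+ 2) ⊛ signedSquare k) ⊛ F (suc k)
      ≐ 1ₛ ⊕ (+ 2) · signedSquares k
  gauss-truncated k = begin
    pochInf (+ 1) r r ⊛ inv (pochInf (- + 1) r r) ⊕ (cst (+ 2) ⊛ μ) ⊛ F′
      ≈⟨ ⊕-cong gauss (≐-refl {(cst (+ 2) ⊛ μ) ⊛ F′}) ⟩
    cst (+ 2) ⊛ F 0 ⊖ 1ₛ ⊕ (cst (+ 2) ⊛ μ) ⊛ F′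
      ≈⟨ ⊕-cong (⊖-cong (⊛-cong (≐-refl {cst (+ 2)}) (F-telescope k)) (≐-refl {1ₛ}))
                (≐-refl {(cst (+ 2) ⊛ μ) ⊛ F′}) ⟩
    cst (+ 2) ⊛ (1ₛ ⊕ T ⊖ μ ⊛ F′) ⊖ 1ₛ ⊕ (cst (+ 2) ⊛ μ) ⊛ F′
      ≈⟨ solve 3 (λ t m f → con (+ 2) :* (con (+ 1) :+ t :- m :* f) :- con (+ 1) :+ (con (+ 2) :* m) :* f
                            := con (+ 1) :+ con (+ 2) :* t) ≐-refl T μ F′ ⟩
    1ₛ ⊕ cst (+ 2) ⊛ T
      ≈⟨ ⊕-cong (≐-refl {1ₛ}) (cst-⊛ (+ 2) T) ⟩
    1ₛ ⊕ (+ 2) · T ∎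
    where
    open ≐-Reasoning
    T  = signedSquares k
    μ  = signedSquare k
    F′ = F (suc k)

  G-as-stated : ∀ k →
    sumInf (λ j → mon (+ 1) ((2 * k + 2 * j + 3) * r * j)
                  ⊛ inv (poch (+ 1) (2 * r) (2 * r) j ⊛ poch (+ 1) r (2 * r) (k + j + 1)))
      ≐ G (suc (suc k)) (suc k)
  G-as-stated k = sumInf-cong λ j → ≡⇒≐ (cong₂ (λ E c → summand E j c) (quadExp-as-stated r k j) (index k j))
    where
    index : ∀ k j → k + j + 1 ≡ suc k + j
    index = solve-∀

theorem1p4 : (k r : ℕ) → 1 ≤ k → 1 ≤ r →
    pochInf (- + 1) 1 1
      ⊛ (cst (+ 1) ⊕ (+ 2) · sumTo k (λ i → mon (sgn (1 + i)) (r * ((1 + i) * (1 + i)))))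
    ≐
    pochInf (- + 1) 1 1 ⊛ pochInf (+ 1) r r ⊛ inv (pochInf (- + 1) r r)
      ⊕ mon ((+ 2) Data.Integer.* sgn k) (r * ((k + 1) * (k + 1)))
        ⊛ pochInf (+ 1) r (2 * r) ⊛ inv (pochInf (+ 1) 1 2)
        ⊛ sumInf (λ j → mon (+ 1) ((2 * k + 2 * j + 3) * r * j)
                        ⊛ inv (poch (+ 1) (2 * r) (2 * r) j ⊛ poch (+ 1) r (2 * r) (k + j + 1)))
theorem1p4 k r _ 1≤r = ≐-sym (begin
  P ⊛ X ⊛ inv Y ⊕ M ⊛ Z ⊛ inv O ⊛ S
    ≈⟨ ⊕-cong (≐-refl {P ⊛ X ⊛ inv Y})
              (⊛-cong (⊛-cong (⊛-cong M≐2μ (≐-refl {Z})) inv-O≐P) (G-as-stated r 1≤r k)) ⟩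
  P ⊛ X ⊛ inv Y ⊕ (cst (+ 2) ⊛ μ) ⊛ Z ⊛ P ⊛ G r 1≤r (suc (suc k)) (suc k)
    ≈⟨ solve 6 (λ p x y m z g → p :* x :* y :+ m :* z :* p :* g := p :* (x :* y :+ m :* (z :* g))) ≐-refl
               P X (inv Y) (cst (+ 2) ⊛ μ) Z (G r 1≤r (suc (suc k)) (suc k)) ⟩
  P ⊛ (X ⊛ inv Y ⊕ (cst (+ 2) ⊛ μ) ⊛ F r 1≤r (suc k))
    ≈⟨ ⊛-cong (≐-refl {P}) (gauss-truncated r 1≤r k) ⟩
  P ⊛ (1ₛ ⊕ (+ 2) · signedSquares r 1≤r k) ∎)
  where
  open ≐-Reasoning
  P = pochInf (- + 1) 1 1
  O = pochInf (+ 1) 1 2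
  X = pochInf (+ 1) r r
  Y = pochInf (- + 1) r r
  Z = pochInf (+ 1) r (2 * r)
  M = mon ((+ 2) Data.Integer.* sgn k) (r * ((k + 1) * (k + 1)))
  S = sumInf (λ j → mon (+ 1) ((2 * k + 2 * j + 3) * r * j)
                    ⊛ inv (poch (+ 1) (2 * r) (2 * r) j ⊛ poch (+ 1) r (2 * r) (k + j + 1)))
  μ = signedSquare r 1≤r k
  M≐2μ : M ≐ cst (+ 2) ⊛ μ
  M≐2μ = ≐-trans (≡⇒≐ (cong (λ m → mon ((+ 2) Data.Integer.* sgn k) (r * (m * m))) (ℕₚ.+-comm k 1)))
                 (mon-*ˡ (+ 2) (sgn k) _)
  inv-O≐P : inv O ≐ P
  inv-O≐P = ≐-sym (inv-unique O P (pochInf-constant-one (+ 1) 2 ℕₚ.≤-refl)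
                              (≐-trans (⊛-comm O P) (euler 1 ℕₚ.≤-refl)))
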